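{- Let $k\in[n-1]$ and $w\in S_n^{k\searrow}$, and suppose there is an increasing $k$-chain from some $u\in S_n$ to $w$. Suppose some step of this chain swaps the values $a<b$, and after this swap the value $b$ is at position $i$. Then: (1) $b$ is not among the first $k$ entries $u(1),\dots,u(k)$ of $u$; (2) for every $c$ with $a<c<b$, $u^{ -1}(c)<i$; (3) for every $c$ with $a<c<b$, the value $c$ is not swapped at any step of the chain.
   Context: $S_n^{k\searrow}=\{w\in S_n: w(k+1)>\dots>w(n)\}$. $t_{p,q}$ is the transposition of $p<q$, $\ell$ the inversion number; $v\lessdot_k v'$ if $v'=vt_{p,q}$ with $p\le k<q$ and $\ell(v')=\ell(v)+1$. An increasing $k$-chain is $(v_1,\dots,v_d)$ with $v_1\lessdot_k\cdots\lessdot_k v_d$ such that the smaller of the two values swapped at each step strictly increases along the chain. -}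

module Defs where

open import Data.Nat using (ℕ; suc; _<_; _≤_; _⊓_)
open import Data.Fin using (Fin; toℕ)
open import Data.Fin.Properties using () renaming (_<?_ to _<ᶠ?_)
open import Data.Fin.Permutation using (Permutation′; _⟨$⟩ʳ_; transpose)
open import Data.List using (List; []; _∷_; length; filter; allFin; cartesianProduct)
open import Data.List.Relation.Unary.Linked using (Linked)
open import Data.Product using (_×_; _,_)
open import Relation.Nullary.Decidable using (_×-dec_)
open import Relation.Binary.PropositionalEquality using (_≡_)

-- Positions and values 1..n of the paper are represented by Fin n (0..n-1);
-- the order is preserved, so paper-position p ≤ k  ⇔  toℕ p < k.

Perm : ℕ → Set
Perm n = Permutation′ n

ℓ : ∀ {n} → Perm n → ℕ
ℓ {n} v = length (filter (λ { (i , j) → (i <ᶠ? j) ×-dec ((v ⟨$⟩ʳ j) <ᶠ? (v ⟨$⟩ʳ i)) })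
                         (cartesianProduct (allFin n) (allFin n)))

Grassmannian↘ : ∀ {n} → ℕ → Perm n → Set
Grassmannian↘ {n} k w = (i j : Fin n) → k ≤ toℕ i → Data.Fin._<_ i j → Data.Fin._<_ (w ⟨$⟩ʳ j) (w ⟨$⟩ʳ i)
  where import Data.Fin

record KCover (n k : ℕ) : Set where
  field
    before after : Perm n
    p q     : Fin n
    p≤k     : toℕ p < k
    k<q     : k ≤ toℕ q
    isSwap  : ∀ x → after ⟨$⟩ʳ x ≡ before ⟨$⟩ʳ (transpose p q ⟨$⟩ʳ x)
    lenStep : ℓ after ≡ suc (ℓ before)

open KCover public

swappedˡ swappedʳ : ∀ {n k} → KCover n k → Fin n
swappedˡ c = before c ⟨$⟩ʳ p c
swappedʳ c = before c ⟨$⟩ʳ q c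

smallerSwapped : ∀ {n k} → KCover n k → ℕ
smallerSwapped c = toℕ (swappedˡ c) ⊓ toℕ (swappedʳ c)

data KChain {n : ℕ} (k : ℕ) : Perm n → Perm n → Set where
  [_] : (v : Perm n) → KChain k v v
  _∷_ : ∀ {w} (c : KCover n k) → KChain k (after c) w → KChain k (before c) w

steps : ∀ {n k} {u w : Perm n} → KChain k u w → List (KCover n k)
steps [ v ] = []
steps (c ∷ ch) = c ∷ steps ch

Increasing : ∀ {n k} {u w : Perm n} → KChain k u w → Set
Increasing ch = Linked (λ c c′ → smallerSwapped c < smallerSwapped c′) (steps ch)

module Submission where

-- A k-cover v ⋖ v·t_{p,q} raises ℓ by exactly one, so v(p) < v(q) and no position strictly
-- between p and q carries a value strictly between them (inversions of v inject into those of
-- v·t_{p,q}, with extra ones otherwise).  In an increasing chain ending in w the smaller value a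
-- swapped by a step is never moved again, so w(q) = a; since w decreases on positions ≥ k, the
-- next step cannot swap a value of (a, b) without jumping over position p, which now holds b.
-- Hence the swapped intervals follow each other, b ≤ a′: values of (a, b) are never swapped,
-- and they and b sit in u where they sit just before the step.  Such a value cannot lie between
-- p and q (cover condition) nor right of q, where w would put it below w(q) = a.

open import Defs
open import Data.Nat using (ℕ; _≤_; _<_; _∸_; suc; z≤n; s≤s; _+_)
open import Data.Nat.Properties
open import Data.Fin using (Fin; toℕ) renaming (_<_ to _<ᶠ_; _≤_ to _≤ᶠ_)
open import Data.Fin.Properties using (toℕ-injective) renaming (_<?_ to _<ᶠ?_; _≟_ to _≟ᶠ_)
open import Data.Fin.Permutation using (_⟨$⟩ʳ_; _⟨$⟩ˡ_; transpose; inverseˡ; inverseʳ)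
open import Data.List using (List; []; _∷_; _++_; length; filter; allFin; cartesianProduct; map)
open import Data.List.Properties using (length-++; length-map)
open import Data.List.Membership.Propositional using (_∈_; _∉_)
open import Data.List.Membership.Propositional.Properties
  using (∈-∃++; ∈-++⁻; ∈-++⁺ˡ; ∈-++⁺ʳ; ∈-filter⁺; ∈-filter⁻; ∈-map⁻; ∈-allFin;
         ∈-cartesianProduct⁺)
open import Data.List.Relation.Unary.Any using (here; there)
open import Data.List.Relation.Unary.All as All using (All; []; _∷_)
open import Data.List.Relation.Unary.AllPairs using ([]; _∷_)
open import Data.List.Relation.Unary.Linked as Linked using ()
open import Data.List.Relation.Unary.Linked.Properties using (Linked⇒AllPairs)
open import Data.List.Relation.Unary.Unique.Propositional using (Unique)
import Data.List.Relation.Unary.Unique.Propositional.Properties as Unique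
open import Data.Product using (_×_; _,_; proj₁; proj₂)
open import Data.Sum using (_⊎_; inj₁; inj₂; [_,_]′)
open import Data.Empty using (⊥; ⊥-elim)
open import Function.Base using (id)
open import Function.Bundles using (Injection)
open import Function.Properties.Inverse using (Inverse⇒Injection)
open import Relation.Nullary using (¬_; yes; no)
open import Relation.Binary.Definitions using (tri<; tri≈; tri>)
open import Relation.Nullary.Decidable using (_×-dec_; _⊎-dec_; dec-true; dec-false)
open import Relation.Unary using (Decidable)
open import Relation.Binary.PropositionalEquality
  using (_≡_; _≢_; refl; sym; trans; cong; cong₂; subst; subst₂)

length-≤-of-⊆ : {A : Set} {xs ys : List A} → Unique xs → (∀ {x} → x ∈ xs → x ∈ ys) →
                length xs ≤ length ys
length-≤-of-⊆ {xs = []} _ _ = z≤n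
length-≤-of-⊆ {A} {x ∷ xs} (x∉xs ∷ xs-unique) xs⊆ys with ∈-∃++ (xs⊆ys (here refl))
... | ys₁ , ys₂ , refl =
  ≤-trans (s≤s (length-≤-of-⊆ xs-unique xs⊆ys₁++ys₂)) (≤-reflexive (length-insert ys₁))
  where
  xs⊆ys₁++ys₂ : ∀ {y} → y ∈ xs → y ∈ ys₁ ++ ys₂
  xs⊆ys₁++ys₂ {y} y∈xs with ∈-++⁻ ys₁ (xs⊆ys (there y∈xs))
  ... | inj₁ y∈ys₁ = ∈-++⁺ˡ y∈ys₁
  ... | inj₂ (here refl) = ⊥-elim (All.lookup x∉xs y∈xs refl)
  ... | inj₂ (there y∈ys₂) = ∈-++⁺ʳ ys₁ y∈ys₂
  length-insert : (zs : List A) → suc (length (zs ++ ys₂)) ≡ length (zs ++ x ∷ ys₂)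
  length-insert [] = refl
  length-insert (_ ∷ zs) = cong suc (length-insert zs)

⟨$⟩ʳ-injective : ∀ {n} (v : Perm n) {i j} → v ⟨$⟩ʳ i ≡ v ⟨$⟩ʳ j → i ≡ j
⟨$⟩ʳ-injective v = Injection.injective (Inverse⇒Injection v)

⟨$⟩ˡ-of-⟨$⟩ʳ : ∀ {n} (v : Perm n) {i y} → v ⟨$⟩ʳ i ≡ y → v ⟨$⟩ˡ y ≡ i
⟨$⟩ˡ-of-⟨$⟩ʳ v refl = inverseˡ v

Inversion : ∀ {n} → Perm n → Fin n × Fin n → Set
Inversion v (i , j) = i <ᶠ j × (v ⟨$⟩ʳ j) <ᶠ (v ⟨$⟩ʳ i)

-- ℓ v is definitionally length (filter (inversion? v) positionPairs).
inversion? : ∀ {n} (v : Perm n) → Decidable (Inversion v)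
inversion? v (i , j) = (i <ᶠ? j) ×-dec ((v ⟨$⟩ʳ j) <ᶠ? (v ⟨$⟩ʳ i))

module _ {n : ℕ} where

  positionPairs : List (Fin n × Fin n)
  positionPairs = cartesianProduct (allFin n) (allFin n)

  ∈-positionPairs : ∀ x → x ∈ positionPairs
  ∈-positionPairs (i , j) = ∈-cartesianProduct⁺ (∈-allFin i) (∈-allFin j)

  ℓ-≤-by-involution : (v v′ : Perm n) (f : Fin n × Fin n → Fin n × Fin n) → (∀ x → f (f x) ≡ x) →
                      (new : List (Fin n × Fin n)) → Unique new → All (Inversion v′) new →
                      (∀ x → Inversion v x → Inversion v′ (f x) × f x ∉ new) →
                      length new + ℓ v ≤ ℓ v′
  ℓ-≤-by-involution v v′ f f-involutive new new-unique new-inv f-maps =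
    subst (_≤ ℓ v′) length-candidates (length-≤-of-⊆ candidates-unique candidates⊆)
    where
    candidates : List (Fin n × Fin n)
    candidates = new ++ map f (filter (inversion? v) positionPairs)
    inversion-of : ∀ {x} → x ∈ filter (inversion? v) positionPairs → Inversion v x
    inversion-of x∈ = proj₂ (∈-filter⁻ (inversion? v) {xs = positionPairs} x∈)
    f-injective : ∀ {x y} → f x ≡ f y → x ≡ y
    f-injective {x} {y} fx≡fy =
      trans (sym (f-involutive x)) (trans (cong f fx≡fy) (f-involutive y))
    disjoint : ∀ {y} → ¬ (y ∈ new × y ∈ map f (filter (inversion? v) positionPairs))
    disjoint (y∈new , y∈image) with ∈-map⁻ f y∈image
    ... | x , x∈ , refl = proj₂ (f-maps x (inversion-of x∈)) y∈new
    candidates-unique : Unique candidates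
    candidates-unique = Unique.++⁺ new-unique
      (Unique.map⁺ f-injective (Unique.filter⁺ (inversion? v)
        (Unique.cartesianProduct⁺ (Unique.allFin⁺ n) (Unique.allFin⁺ n))))
      disjoint
    candidates⊆ : ∀ {y} → y ∈ candidates → y ∈ filter (inversion? v′) positionPairs
    candidates⊆ {y} y∈ with ∈-++⁻ new y∈
    ... | inj₁ y∈new = ∈-filter⁺ (inversion? v′) (∈-positionPairs y) (All.lookup new-inv y∈new)
    ... | inj₂ y∈image with ∈-map⁻ f y∈image
    ...   | x , x∈ , refl = ∈-filter⁺ (inversion? v′) (∈-positionPairs (f x))
                              (proj₁ (f-maps x (inversion-of x∈)))
    length-candidates : length candidates ≡ length new + ℓ v
    length-candidates =
      trans (length-++ new) (cong (length new +_) (length-map f (filter (inversion? v) positionPairs)))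

-- For v′ = v ∘ (p q) with v p < v q, pairs of positions whose order τ = (p q) preserves are
-- matched with their τ-images; the remaining "special" pairs, one end in {p, q} and the other
-- in [p, q], are matched with themselves, and every inversion of v among them is one of v′.
module Transposition {n : ℕ} (p q : Fin n) (p<q : p <ᶠ q) where

  τ : Fin n → Fin n
  τ x = transpose p q ⟨$⟩ʳ x

  p≢q : p ≢ q
  p≢q p≡q = <-irrefl (cong toℕ p≡q) p<q

  τ-p : τ p ≡ q
  τ-p rewrite dec-true (p ≟ᶠ p) refl = refl

  τ-q : τ q ≡ p
  τ-q rewrite dec-false (q ≟ᶠ p) (λ q≡p → p≢q (sym q≡p)) | dec-true (q ≟ᶠ q) refl = refl

  τ-other : ∀ {x} → x ≢ p → x ≢ q → τ x ≡ x
  τ-other {x} x≢p x≢q rewrite dec-false (x ≟ᶠ p) x≢p | dec-false (x ≟ᶠ q) x≢q = refl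

  data Place (x : Fin n) : Set where
    at-p : x ≡ p → Place x
    at-q : x ≡ q → Place x
    elsewhere : x ≢ p → x ≢ q → Place x

  place : ∀ x → Place x
  place x with x ≟ᶠ p | x ≟ᶠ q
  ... | yes x≡p | _ = at-p x≡p
  ... | no _ | yes x≡q = at-q x≡q
  ... | no x≢p | no x≢q = elsewhere x≢p x≢q

  τ-involutive : ∀ x → τ (τ x) ≡ x
  τ-involutive x with place x
  ... | at-p refl = trans (cong τ τ-p) τ-q
  ... | at-q refl = trans (cong τ τ-q) τ-p
  ... | elsewhere x≢p x≢q = trans (cong τ (τ-other x≢p x≢q)) (τ-other x≢p x≢q)

  Between : Fin n → Set
  Between x = p ≤ᶠ x × x ≤ᶠ q

  Endpoint : Fin n → Set
  Endpoint x = x ≡ p ⊎ x ≡ q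

  Special : Fin n × Fin n → Set
  Special (i , j) = (Endpoint i × Between j) ⊎ (Endpoint j × Between i)

  special? : Decidable Special
  special? (i , j) = (endpoint? i ×-dec between? j) ⊎-dec (endpoint? j ×-dec between? i)
    where
    endpoint? : Decidable Endpoint
    endpoint? x = (x ≟ᶠ p) ⊎-dec (x ≟ᶠ q)
    between? : Decidable Between
    between? x = (toℕ p ≤? toℕ x) ×-dec (toℕ x ≤? toℕ q)

  τ² : Fin n × Fin n → Fin n × Fin n
  τ² (i , j) = τ i , τ j

  τ²-involutive : ∀ x → τ² (τ² x) ≡ x
  τ²-involutive (i , j) = cong₂ _,_ (τ-involutive i) (τ-involutive j)

  endpoint-τ : ∀ {x} → Endpoint x → Endpoint (τ x)
  endpoint-τ (inj₁ refl) = inj₂ τ-p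
  endpoint-τ (inj₂ refl) = inj₁ τ-q

  between-τ : ∀ {x} → Between x → Between (τ x)
  between-τ {x} b with place x
  ... | at-p refl rewrite τ-p = <⇒≤ p<q , ≤-refl
  ... | at-q refl rewrite τ-q = ≤-refl , <⇒≤ p<q
  ... | elsewhere x≢p x≢q rewrite τ-other x≢p x≢q = b

  special-τ² : ∀ {x} → Special x → Special (τ² x)
  special-τ² (inj₁ (e , b)) = inj₁ (endpoint-τ e , between-τ b)
  special-τ² (inj₂ (e , b)) = inj₂ (endpoint-τ e , between-τ b)

  τ-monotone-off-special : ∀ i j → i <ᶠ j → ¬ Special (i , j) → τ i <ᶠ τ j
  τ-monotone-off-special i j i<j ¬special with place i | place j
  ... | at-p refl | at-p refl = ⊥-elim (<-irrefl refl i<j)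
  ... | at-p refl | at-q refl = ⊥-elim (¬special (inj₁ (inj₁ refl , <⇒≤ p<q , ≤-refl)))
  ... | at-p refl | elsewhere j≢p j≢q rewrite τ-p | τ-other j≢p j≢q with toℕ q <? toℕ j
  ...   | yes q<j = q<j
  ...   | no q≮j = ⊥-elim (¬special (inj₁ (inj₁ refl , <⇒≤ i<j , ≮⇒≥ q≮j)))
  τ-monotone-off-special i j i<j ¬special | at-q refl | at-p refl = ⊥-elim (<-asym i<j p<q)
  τ-monotone-off-special i j i<j ¬special | at-q refl | at-q refl = ⊥-elim (<-irrefl refl i<j)
  τ-monotone-off-special i j i<j ¬special | at-q refl | elsewhere j≢p j≢q
    rewrite τ-q | τ-other j≢p j≢q = <-trans p<q i<j
  τ-monotone-off-special i j i<j ¬special | elsewhere i≢p i≢q | at-p refl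
    rewrite τ-p | τ-other i≢p i≢q = <-trans i<j p<q
  τ-monotone-off-special i j i<j ¬special | elsewhere i≢p i≢q | at-q refl
    rewrite τ-q | τ-other i≢p i≢q with toℕ i <? toℕ p
  ...   | yes i<p = i<p
  ...   | no i≮p = ⊥-elim (¬special (inj₂ (inj₂ refl , ≮⇒≥ i≮p , <⇒≤ i<j)))
  τ-monotone-off-special i j i<j ¬special | elsewhere i≢p i≢q | elsewhere j≢p j≢q
    rewrite τ-other i≢p i≢q | τ-other j≢p j≢q = i<j

  σ : Fin n × Fin n → Fin n × Fin n
  σ x with special? x
  ... | yes _ = x
  ... | no _ = τ² x

  σ-special : ∀ {x} → Special x → σ x ≡ x
  σ-special {x} s with special? x
  ... | yes _ = refl
  ... | no ¬s = ⊥-elim (¬s s)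

  σ-nonspecial : ∀ {x} → ¬ Special x → σ x ≡ τ² x
  σ-nonspecial {x} ¬s with special? x
  ... | yes s = ⊥-elim (¬s s)
  ... | no _ = refl

  nonspecial-τ² : ∀ {x} → ¬ Special x → ¬ Special (τ² x)
  nonspecial-τ² {x} ¬s s = ¬s (subst Special (τ²-involutive x) (special-τ² s))

  σ-involutive : ∀ x → σ (σ x) ≡ x
  σ-involutive x with special? x
  ... | yes s = σ-special s
  ... | no ¬s = trans (σ-nonspecial (nonspecial-τ² ¬s)) (τ²-involutive x)

  module Ascent (v v′ : Perm n) (v′≡v∘τ : ∀ x → v′ ⟨$⟩ʳ x ≡ v ⟨$⟩ʳ τ x)
                (ascent : (v ⟨$⟩ʳ p) <ᶠ (v ⟨$⟩ʳ q)) where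

    v′-p : v′ ⟨$⟩ʳ p ≡ v ⟨$⟩ʳ q
    v′-p = trans (v′≡v∘τ p) (cong (v ⟨$⟩ʳ_) τ-p)

    v′-q : v′ ⟨$⟩ʳ q ≡ v ⟨$⟩ʳ p
    v′-q = trans (v′≡v∘τ q) (cong (v ⟨$⟩ʳ_) τ-q)

    v′-other : ∀ {x} → x ≢ p → x ≢ q → v′ ⟨$⟩ʳ x ≡ v ⟨$⟩ʳ x
    v′-other x≢p x≢q = trans (v′≡v∘τ _) (cong (v ⟨$⟩ʳ_) (τ-other x≢p x≢q))

    v′∘τ≡v : ∀ x → v′ ⟨$⟩ʳ τ x ≡ v ⟨$⟩ʳ x
    v′∘τ≡v x = trans (v′≡v∘τ (τ x)) (cong (v ⟨$⟩ʳ_) (τ-involutive x))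

    inversion-special : ∀ x → Special x → Inversion v x → Inversion v′ x
    inversion-special (i , j) s (i<j , vj<vi) with place i | place j | s
    ... | at-p refl | at-p refl | _ = ⊥-elim (<-irrefl refl i<j)
    ... | at-p refl | at-q refl | _ = ⊥-elim (<-asym vj<vi ascent)
    ... | at-p refl | elsewhere j≢p j≢q | _ rewrite v′-p | v′-other j≢p j≢q =
      i<j , <-trans vj<vi ascent
    ... | at-q refl | at-p refl | _ = ⊥-elim (<-asym i<j p<q)
    ... | at-q refl | at-q refl | _ = ⊥-elim (<-irrefl refl i<j)
    ... | at-q refl | elsewhere _ _ | inj₁ (_ , _ , j≤q) = ⊥-elim (<⇒≱ i<j j≤q)
    ... | at-q refl | elsewhere j≢p _ | inj₂ (inj₁ j≡p , _) = ⊥-elim (j≢p j≡p)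
    ... | at-q refl | elsewhere _ j≢q | inj₂ (inj₂ j≡q , _) = ⊥-elim (j≢q j≡q)
    ... | elsewhere i≢p _ | at-p refl | inj₁ (inj₁ i≡p , _) = ⊥-elim (i≢p i≡p)
    ... | elsewhere _ i≢q | at-p refl | inj₁ (inj₂ i≡q , _) = ⊥-elim (i≢q i≡q)
    ... | elsewhere _ _ | at-p refl | inj₂ (_ , p≤i , _) = ⊥-elim (<⇒≱ i<j p≤i)
    ... | elsewhere i≢p i≢q | at-q refl | _ rewrite v′-q | v′-other i≢p i≢q =
      i<j , <-trans ascent vj<vi
    ... | elsewhere i≢p _ | elsewhere _ _ | inj₁ (inj₁ i≡p , _) = ⊥-elim (i≢p i≡p)
    ... | elsewhere _ i≢q | elsewhere _ _ | inj₁ (inj₂ i≡q , _) = ⊥-elim (i≢q i≡q)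
    ... | elsewhere _ _ | elsewhere j≢p _ | inj₂ (inj₁ j≡p , _) = ⊥-elim (j≢p j≡p)
    ... | elsewhere _ _ | elsewhere _ j≢q | inj₂ (inj₂ j≡q , _) = ⊥-elim (j≢q j≡q)

    inversion-σ : ∀ x → Inversion v x → Inversion v′ (σ x)
    inversion-σ x inv with special? x
    ... | yes s = inversion-special x s inv
    inversion-σ (i , j) (i<j , vj<vi) | no ¬s =
      τ-monotone-off-special i j i<j ¬s ,
      subst₂ _<ᶠ_ (sym (v′∘τ≡v j)) (sym (v′∘τ≡v i)) vj<vi

    ℓ-≤-by-special-inversions : (new : List (Fin n × Fin n)) → Unique new →
                                All (λ x → Special x × ¬ Inversion v x × Inversion v′ x) new →
                                length new + ℓ v ≤ ℓ v′
    ℓ-≤-by-special-inversions new new-unique new-props =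
      ℓ-≤-by-involution v v′ σ σ-involutive new new-unique
        (All.map (λ z → proj₂ (proj₂ z)) new-props)
        (λ x inv → inversion-σ x inv , σx∉new x inv)
      where
      σx∉new : ∀ x → Inversion v x → σ x ∉ new
      σx∉new x inv σx∈new with special? x | All.lookup new-props σx∈new
      ... | yes _ | _ , ¬inv , _ = ¬inv inv
      ... | no ¬s | s , _ , _ = nonspecial-τ² ¬s s

    new-inversion-pq : Special (p , q) × ¬ Inversion v (p , q) × Inversion v′ (p , q)
    new-inversion-pq =
      inj₁ (inj₁ refl , <⇒≤ p<q , ≤-refl) ,
      (λ inv → <-asym (proj₂ inv) ascent) ,
      (p<q , subst₂ _<ᶠ_ (sym v′-q) (sym v′-p) ascent)

    1+ℓ≤ℓ : 1 + ℓ v ≤ ℓ v′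
    1+ℓ≤ℓ = ℓ-≤-by-special-inversions ((p , q) ∷ []) ([] ∷ []) (new-inversion-pq ∷ [])

    2+ℓ≤ℓ : ∀ m → p <ᶠ m → m <ᶠ q →
            (v ⟨$⟩ʳ p) <ᶠ (v ⟨$⟩ʳ m) → (v ⟨$⟩ʳ m) <ᶠ (v ⟨$⟩ʳ q) →
            2 + ℓ v ≤ ℓ v′
    2+ℓ≤ℓ m p<m m<q vp<vm vm<vq =
      ℓ-≤-by-special-inversions ((p , q) ∷ (p , m) ∷ [])
        (((λ pq≡pm → m≢q (sym (cong proj₂ pq≡pm))) ∷ []) ∷ [] ∷ [])
        (new-inversion-pq ∷ new-inversion-pm ∷ [])
      where
      m≢p : m ≢ p
      m≢p m≡p = <-irrefl (cong toℕ (sym m≡p)) p<m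
      m≢q : m ≢ q
      m≢q m≡q = <-irrefl (cong toℕ m≡q) m<q
      new-inversion-pm : Special (p , m) × ¬ Inversion v (p , m) × Inversion v′ (p , m)
      new-inversion-pm =
        inj₁ (inj₁ refl , <⇒≤ p<m , <⇒≤ m<q) ,
        (λ inv → <-asym (proj₂ inv) vp<vm) ,
        (p<m , subst₂ _<ᶠ_ (sym (v′-other m≢p m≢q)) (sym v′-p) vm<vq)

Unswapped : ∀ {n k} → KCover n k → Fin n → Set
Unswapped d x = swappedˡ d ≢ x × swappedʳ d ≢ x

module Cover {n k : ℕ} (c : KCover n k) where

  p<q : p c <ᶠ q c
  p<q = <-≤-trans (p≤k c) (k<q c)

  open Transposition (p c) (q c) p<q

  after-p : after c ⟨$⟩ʳ p c ≡ swappedʳ c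
  after-p = trans (isSwap c (p c)) (cong (before c ⟨$⟩ʳ_) τ-p)

  after-q : after c ⟨$⟩ʳ q c ≡ swappedˡ c
  after-q = trans (isSwap c (q c)) (cong (before c ⟨$⟩ʳ_) τ-q)

  after-other : ∀ {x} → x ≢ p c → x ≢ q c → after c ⟨$⟩ʳ x ≡ before c ⟨$⟩ʳ x
  after-other x≢p x≢q = trans (isSwap c _) (cong (before c ⟨$⟩ʳ_) (τ-other x≢p x≢q))

  -- Otherwise the step would be a descent, decreasing ℓ.
  swappedˡ<swappedʳ : swappedˡ c <ᶠ swappedʳ c
  swappedˡ<swappedʳ with <-cmp (toℕ (swappedˡ c)) (toℕ (swappedʳ c))
  ... | tri< lo<hi _ _ = lo<hi
  ... | tri≈ _ lo≡hi _ = ⊥-elim (p≢q (⟨$⟩ʳ-injective (before c) (toℕ-injective lo≡hi)))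
  ... | tri> _ _ hi<lo =
    ⊥-elim (1+n≰n (≤-trans (n≤1+n _)
                             (subst (λ l → 1 + l ≤ ℓ (before c)) (lenStep c) ℓ-after<ℓ-before)))
    where
    before≡after∘τ : ∀ x → before c ⟨$⟩ʳ x ≡ after c ⟨$⟩ʳ τ x
    before≡after∘τ x = trans (cong (before c ⟨$⟩ʳ_) (sym (τ-involutive x))) (sym (isSwap c (τ x)))
    ℓ-after<ℓ-before : 1 + ℓ (after c) ≤ ℓ (before c)
    ℓ-after<ℓ-before = Ascent.1+ℓ≤ℓ (after c) (before c) before≡after∘τ
                         (subst₂ _<ᶠ_ (sym after-p) (sym after-q) hi<lo)

  -- Otherwise ℓ would grow by at least two.
  no-value-between : ∀ m → p c <ᶠ m → m <ᶠ q c →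
                     swappedˡ c <ᶠ (before c ⟨$⟩ʳ m) → (before c ⟨$⟩ʳ m) <ᶠ swappedʳ c → ⊥
  no-value-between m p<m m<q lo<vm vm<hi =
    1+n≰n (subst (2 + ℓ (before c) ≤_) (lenStep c)
      (Ascent.2+ℓ≤ℓ (before c) (after c) (isSwap c) swappedˡ<swappedʳ m p<m m<q lo<vm vm<hi))

  position-outside : ∀ {m} → swappedˡ c <ᶠ (before c ⟨$⟩ʳ m) →
                     (before c ⟨$⟩ʳ m) <ᶠ swappedʳ c →
                     m <ᶠ p c ⊎ q c <ᶠ m
  position-outside {m} lo<vm vm<hi with <-cmp (toℕ m) (toℕ (p c)) | <-cmp (toℕ m) (toℕ (q c))
  ... | tri< m<p _ _ | _ = inj₁ m<p
  ... | tri≈ _ m≡p _ | _ =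
    ⊥-elim (<-irrefl (cong (λ x → toℕ (before c ⟨$⟩ʳ x)) (sym (toℕ-injective m≡p))) lo<vm)
  ... | tri> _ _ _ | tri≈ _ m≡q _ =
    ⊥-elim (<-irrefl (cong (λ x → toℕ (before c ⟨$⟩ʳ x)) (toℕ-injective m≡q)) vm<hi)
  ... | tri> _ _ p<m | tri< m<q _ _ = ⊥-elim (no-value-between m p<m m<q lo<vm vm<hi)
  ... | tri> _ _ _ | tri> _ _ q<m = inj₂ q<m

  after-position-outside : ∀ {m} → swappedˡ c <ᶠ (after c ⟨$⟩ʳ m) →
                           (after c ⟨$⟩ʳ m) <ᶠ swappedʳ c →
                           m <ᶠ p c ⊎ q c <ᶠ m
  after-position-outside {m} lo<vm vm<hi =
    position-outside (subst (swappedˡ c <ᶠ_) after≡before lo<vm)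
                     (subst (_<ᶠ swappedʳ c) after≡before vm<hi)
    where
    m≢p : m ≢ p c
    m≢p refl = <-irrefl (cong toℕ after-p) vm<hi
    m≢q : m ≢ q c
    m≢q refl = <-irrefl (cong toℕ (sym after-q)) lo<vm
    after≡before : after c ⟨$⟩ʳ m ≡ before c ⟨$⟩ʳ m
    after≡before = after-other m≢p m≢q

  inverse-unswapped : ∀ {y} → Unswapped c y → before c ⟨$⟩ˡ y ≡ after c ⟨$⟩ˡ y
  inverse-unswapped {y} (lo≢y , hi≢y) =
    sym (⟨$⟩ˡ-of-⟨$⟩ʳ (after c) (trans (after-other j≢p j≢q) (inverseʳ (before c))))
    where
    j : Fin n
    j = before c ⟨$⟩ˡ y
    j≢p : j ≢ p c
    j≢p j≡p = lo≢y (trans (cong (before c ⟨$⟩ʳ_) (sym j≡p)) (inverseʳ (before c)))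
    j≢q : j ≢ q c
    j≢q j≡q = hi≢y (trans (cong (before c ⟨$⟩ʳ_) (sym j≡q)) (inverseʳ (before c)))

module _ {n k : ℕ} where

  unswapped-above : ∀ (d : KCover n k) {x} → x <ᶠ swappedˡ d → Unswapped d x
  unswapped-above d x<lo =
    (λ lo≡x → <-irrefl (cong toℕ (sym lo≡x)) x<lo) ,
    (λ hi≡x → <-irrefl (cong toℕ (sym hi≡x)) (<-trans x<lo (Cover.swappedˡ<swappedʳ d)))

  unswapped-below : ∀ (d : KCover n k) {x} → swappedʳ d <ᶠ x → Unswapped d x
  unswapped-below d hi<x =
    (λ lo≡x → <-irrefl (cong toℕ lo≡x) (<-trans (Cover.swappedˡ<swappedʳ d) hi<x)) ,
    (λ hi≡x → <-irrefl (cong toℕ hi≡x) hi<x)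

  unswapped-inside : ∀ (d : KCover n k) {x} → swappedˡ d <ᶠ x → x <ᶠ swappedʳ d → Unswapped d x
  unswapped-inside d lo<x x<hi =
    (λ lo≡x → <-irrefl (cong toℕ lo≡x) lo<x) , (λ hi≡x → <-irrefl (cong toℕ (sym hi≡x)) x<hi)

  swappedˡ-increasing : ∀ {c} {w : Perm n} {ch : KChain k (after c) w} → Increasing (c ∷ ch) →
                        ∀ {d} → d ∈ steps ch → swappedˡ c <ᶠ swappedˡ d
  swappedˡ-increasing {c} inc {d} d∈ch with Linked⇒AllPairs (λ {x} {y} {z} → <-trans) inc
  ... | c<ch ∷ _ =
    subst₂ _<_ (smallerSwapped≡swappedˡ c) (smallerSwapped≡swappedˡ d) (All.lookup c<ch d∈ch)
    where
    smallerSwapped≡swappedˡ : (e : KCover n k) → smallerSwapped e ≡ toℕ (swappedˡ e)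
    smallerSwapped≡swappedˡ e = m≤n⇒m⊓n≡m (<⇒≤ (Cover.swappedˡ<swappedʳ e))

  inverse-invariant : ∀ {v w : Perm n} {y} (ch : KChain k v w) →
                      (∀ {d} → d ∈ steps ch → Unswapped d y) → v ⟨$⟩ˡ y ≡ w ⟨$⟩ˡ y
  inverse-invariant [ _ ] _ = refl
  inverse-invariant (c ∷ ch) unswapped =
    trans (Cover.inverse-unswapped c (unswapped (here refl)))
          (inverse-invariant ch (λ d∈ch → unswapped (there d∈ch)))

  -- Later steps swap only values larger than swappedˡ d, so it stays at q d.
  final-at-q : ∀ {v w : Perm n} (ch : KChain k v w) → Increasing ch → ∀ {d} → d ∈ steps ch →
               w ⟨$⟩ʳ q d ≡ swappedˡ d
  final-at-q {w = w} (c ∷ ch) inc (here refl) = trans (cong (w ⟨$⟩ʳ_) (sym w⁻¹lo≡q)) (inverseʳ w)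
    where
    w⁻¹lo≡q : w ⟨$⟩ˡ swappedˡ c ≡ q c
    w⁻¹lo≡q = trans (sym (inverse-invariant ch
                            (λ {d} d∈ch → unswapped-above d (swappedˡ-increasing inc d∈ch))))
                    (⟨$⟩ˡ-of-⟨$⟩ʳ (after c) (Cover.after-q c))
  final-at-q (c ∷ ch) inc (there d∈ch) = final-at-q ch (Linked.tail inc) d∈ch

  module _ {w : Perm n} (gw : Grassmannian↘ k w) where

    Grassmannian↘-bound : ∀ {j m} → k ≤ toℕ j → (w ⟨$⟩ʳ j) <ᶠ (w ⟨$⟩ʳ m) → m ≤ᶠ j
    Grassmannian↘-bound {j} {m} k≤j wj<wm = ≮⇒≥ (λ j<m → <-asym wj<wm (gw j m k≤j j<m))

    -- If swappedˡ e were below swappedʳ c, then p e < p c < q e (q e ≤ q c because w decreases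
    -- right of k), and after c holds swappedʳ c at p c: strictly between the values e swaps.
    swappedʳ-≤-next : (c e : KCover n k) → before e ≡ after c →
                      w ⟨$⟩ʳ q c ≡ swappedˡ c → w ⟨$⟩ʳ q e ≡ swappedˡ e →
                      swappedˡ c <ᶠ swappedˡ e → swappedʳ c ≤ᶠ swappedˡ e
    swappedʳ-≤-next c e refl w-qc w-qe a<lo = ≮⇒≥ lo-not-below-b
      where
      module C = Cover c
      p<qe : p c <ᶠ q e
      p<qe = <-≤-trans (p≤k c) (k<q e)
      qe≤q : q e ≤ᶠ q c
      qe≤q = Grassmannian↘-bound (k<q c) (subst₂ _<ᶠ_ (sym w-qc) (sym w-qe) a<lo)
      b<hi : swappedʳ c <ᶠ swappedʳ e
      b<hi with <-cmp (toℕ (swappedʳ e)) (toℕ (swappedʳ c))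
      ... | tri< hi<b _ _ =
        ⊥-elim ([ (λ qe<p → <-asym qe<p p<qe) , (λ q<qe → <⇒≱ q<qe qe≤q) ]′
                  (C.after-position-outside (<-trans a<lo (Cover.swappedˡ<swappedʳ e)) hi<b))
      ... | tri≈ _ hi≡b _ =
        ⊥-elim (<-irrefl (cong toℕ (sym qe≡p)) p<qe)
        where
        qe≡p : q e ≡ p c
        qe≡p = ⟨$⟩ʳ-injective (after c) (trans (toℕ-injective hi≡b) (sym C.after-p))
      ... | tri> _ _ b<hi = b<hi
      lo-not-below-b : swappedˡ e <ᶠ swappedʳ c → ⊥
      lo-not-below-b lo<b =
        Cover.no-value-between e (p c) pe<p p<qe
          (subst (swappedˡ e <ᶠ_) (sym C.after-p) lo<b) (subst (_<ᶠ swappedʳ e) (sym C.after-p) b<hi)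
        where
        pe<p : p e <ᶠ p c
        pe<p = [ id , (λ q<pe → ⊥-elim (<-asym q<pe (<-≤-trans (p≤k e) (k<q c)))) ]′
                 (C.after-position-outside a<lo lo<b)

    swappedʳ-≤-later : (c : KCover n k) (ch : KChain k (after c) w) →
                       Increasing (c ∷ ch) → ∀ {d} → d ∈ steps ch → swappedʳ c ≤ᶠ swappedˡ d
    swappedʳ-≤-later c (e ∷ rest) inc d∈ch = ≤-trans b≤lo-e (lo-e≤lo-d d∈ch)
      where
      b≤lo-e : swappedʳ c ≤ᶠ swappedˡ e
      b≤lo-e = swappedʳ-≤-next c e refl (final-at-q (c ∷ e ∷ rest) inc (here refl))
                 (final-at-q (c ∷ e ∷ rest) inc (there (here refl))) (swappedˡ-increasing inc (here refl))
      lo-e≤lo-d : ∀ {d} → d ∈ steps (e ∷ rest) → swappedˡ e ≤ᶠ swappedˡ d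
      lo-e≤lo-d (here refl) = ≤-refl
      lo-e≤lo-d (there d∈rest) = <⇒≤ (swappedˡ-increasing (Linked.tail inc) d∈rest)

    interior-unswapped : ∀ {u} (ch : KChain k u w) → Increasing ch → ∀ {c d x} →
                         c ∈ steps ch → d ∈ steps ch →
                         swappedˡ c <ᶠ x → x <ᶠ swappedʳ c → Unswapped d x
    interior-unswapped (c ∷ ch) inc (here refl) (here refl) a<x x<b = unswapped-inside c a<x x<b
    interior-unswapped (c ∷ ch) inc {d = d} (here refl) (there d∈ch) a<x x<b =
      unswapped-above d (<-≤-trans x<b (swappedʳ-≤-later c ch inc d∈ch))
    interior-unswapped (d ∷ ch) inc (there c∈ch) (here refl) a<x x<b =
      unswapped-below d (≤-<-trans (swappedʳ-≤-later d ch inc c∈ch) a<x)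
    interior-unswapped (_ ∷ ch) inc (there c∈ch) (there d∈ch) a<x x<b =
      interior-unswapped ch (Linked.tail inc) c∈ch d∈ch a<x x<b

    -- Every step before c swaps only values ≤ swappedˡ c.
    inverse-before-step : ∀ {u} (ch : KChain k u w) → Increasing ch → ∀ {c y} → c ∈ steps ch →
                          swappedˡ c <ᶠ y → u ⟨$⟩ˡ y ≡ before c ⟨$⟩ˡ y
    inverse-before-step (c ∷ ch) inc (here refl) a<y = refl
    inverse-before-step (d ∷ ch) inc (there c∈ch) a<y =
      trans (Cover.inverse-unswapped d
               (unswapped-below d (≤-<-trans (swappedʳ-≤-later d ch inc c∈ch) a<y)))
            (inverse-before-step ch (Linked.tail inc) c∈ch a<y)

    swappedʳ-starts-at-q : ∀ {u} (ch : KChain k u w) → Increasing ch → ∀ {c} → c ∈ steps ch →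
                           u ⟨$⟩ˡ swappedʳ c ≡ q c
    swappedʳ-starts-at-q ch inc {c} c∈ch =
      trans (inverse-before-step ch inc c∈ch (Cover.swappedˡ<swappedʳ c)) (inverseˡ (before c))

    -- x is never swapped, so w also has it at m; right of q c, where w is decreasing, it
    -- would lie below w (q c) = swappedˡ c.
    interior-starts-left-of-p : ∀ {u} (ch : KChain k u w) → Increasing ch →
                                ∀ {c x} → c ∈ steps ch →
                                swappedˡ c <ᶠ x → x <ᶠ swappedʳ c → (u ⟨$⟩ˡ x) <ᶠ p c
    interior-starts-left-of-p {u} ch inc {c} {x} c∈ch a<x x<b =
      [ id , (λ q<m → ⊥-elim (<⇒≱ q<m m≤q)) ]′
        (Cover.position-outside c (subst (swappedˡ c <ᶠ_) (sym B-m) a<x)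
                                  (subst (_<ᶠ swappedʳ c) (sym B-m) x<b))
      where
      m : Fin n
      m = u ⟨$⟩ˡ x
      m≡B⁻¹x : m ≡ before c ⟨$⟩ˡ x
      m≡B⁻¹x = inverse-before-step ch inc c∈ch a<x
      B-m : before c ⟨$⟩ʳ m ≡ x
      B-m = trans (cong (before c ⟨$⟩ʳ_) m≡B⁻¹x) (inverseʳ (before c))
      w-m : w ⟨$⟩ʳ m ≡ x
      w-m = trans (cong (w ⟨$⟩ʳ_)
                    (inverse-invariant ch (λ d∈ch → interior-unswapped ch inc c∈ch d∈ch a<x x<b)))
                  (inverseʳ w)
      m≤q : m ≤ᶠ q c
      m≤q = Grassmannian↘-bound (k<q c) (subst₂ _<ᶠ_ (sym (final-at-q ch inc c∈ch)) (sym w-m) a<x)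

lemma3p14 : (n k : ℕ) → 1 ≤ k → k ≤ n ∸ 1 →
    (w u : Perm n) → Grassmannian↘ k w →
    (ch : KChain k u w) → Increasing ch →
    (c : KCover n k) → c ∈ steps ch →
    (a b i : Fin n) → Data.Fin._<_ a b →
    ((swappedˡ c ≡ a × swappedʳ c ≡ b) ⊎ (swappedˡ c ≡ b × swappedʳ c ≡ a)) →
    after c ⟨$⟩ʳ i ≡ b →
    ((j : Fin n) → toℕ j < k → u ⟨$⟩ʳ j ≢ b)
    × ((x : Fin n) → Data.Fin._<_ a x → Data.Fin._<_ x b → Data.Fin._<_ (u ⟨$⟩ˡ x) i)
    × ((x : Fin n) → Data.Fin._<_ a x → Data.Fin._<_ x b →
         (d : KCover n k) → d ∈ steps ch → swappedˡ d ≢ x × swappedʳ d ≢ x)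
lemma3p14 n k _ _ w u gw ch inc c c∈ch _ _ i b<a (inj₂ (refl , refl)) _ =
  ⊥-elim (<-asym b<a (Cover.swappedˡ<swappedʳ c))
lemma3p14 n k _ _ w u gw ch inc c c∈ch _ _ i _ (inj₁ (refl , refl)) after-i≡b =
  b-not-among-first-k ,
  (λ x a<x x<b → subst ((u ⟨$⟩ˡ x) <ᶠ_) (sym i≡p)
                   (interior-starts-left-of-p gw ch inc c∈ch a<x x<b)) ,
  (λ x a<x x<b d d∈ch → interior-unswapped gw ch inc c∈ch d∈ch a<x x<b)
  where
  i≡p : i ≡ p c
  i≡p = ⟨$⟩ʳ-injective (after c) (trans after-i≡b (sym (Cover.after-p c)))
  b-not-among-first-k : (j : Fin n) → toℕ j < k → u ⟨$⟩ʳ j ≢ swappedʳ c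
  b-not-among-first-k j j<k uj≡b = <-irrefl (cong toℕ j≡q) (<-≤-trans j<k (k<q c))
    where
    j≡q : j ≡ q c
    j≡q = trans (sym (⟨$⟩ˡ-of-⟨$⟩ʳ u uj≡b)) (swappedʳ-starts-at-q gw ch inc c∈ch)
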